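{- For every even integer $n \geq 4$, the prism $D_n$ satisfies $\mu_s(D_n) \leq n+1$.
   Context: All graphs are finite and simple. For integers $a\le b$, $[a,b]$ denotes the set of integers $x$ with $a\le x\le b$. The prism $D_n$ is the Cartesian product $C_n \square K_2$ of the cycle $C_n$ of order $n$ and the complete graph $K_2$; it has $2n$ vertices and $3n$ edges. A graph $G$ is super edge-magic if there is a bijection $f:V(G)\cup E(G)\to[1,|V(G)|+|E(G)|]$ with $f(V(G))=[1,|V(G)|]$ such that $f(u)+f(v)+f(uv)$ is the same constant for every edge $uv\in E(G)$. The super edge-magic deficiency $\mu_s(G)$ of a graph $G$ is the smallest nonnegative integer $k$ such that the disjoint union $G\cup kK_1$ of $G$ with $k$ isolated vertices is super edge-magic, or $+\infty$ if no such $k$ exists. -}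

module Defs where

open import Data.Nat using (ℕ; zero; suc; _+_; _<_; _≤_)
open import Data.Nat.DivMod using (_mod_)
open import Data.Fin using (Fin; toℕ; _↑ˡ_; _↑ʳ_; splitAt)
open import Data.Sum using (_⊎_; inj₁; inj₂)
open import Data.Product using (Σ; ∃; ∃-syntax; _×_; _,_; proj₁; proj₂)
open import Function.Bundles using (_⤖_; module Bijection)
open import Relation.Binary.PropositionalEquality using (_≡_)

record Graph : Set where
  field
    order : ℕ
    size  : ℕ
    ends  : Fin size → Fin order × Fin order
open Graph public

addIsolated : Graph → ℕ → Graph
addIsolated G k = record
  { order = order G + k
  ; size  = size G
  ; ends  = λ e → (proj₁ (ends G e) ↑ˡ k , proj₂ (ends G e) ↑ˡ k)
  }

next : ∀ {n} → Fin n → Fin n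
next {suc m} i = suc (toℕ i) mod (suc m)

-- Prism D_n = C_n □ K_2 : vertices u_i = i (i < n) and v_i = n + i;
-- edges: u_i u_{i+1}, v_i v_{i+1}, u_i v_i  (3n edges, indexed by Fin (n + n + n)).
prism : ℕ → Graph
prism n = record
  { order = n + n
  ; size  = n + n + n
  ; ends  = edge
  }
  where
  u v : Fin n → Fin (n + n)
  u i = i ↑ˡ n
  v i = n ↑ʳ i
  edge : Fin (n + n + n) → Fin (n + n) × Fin (n + n)
  edge e with splitAt (n + n) e
  ... | inj₂ i = (u i , v i)
  ... | inj₁ e′ with splitAt n e′
  ...   | inj₁ i = (u i , u (next i))
  ...   | inj₂ i = (v i , v (next i))

-- Super edge-magic: a bijection f : V(G) ∪ E(G) → [1, |V|+|E|]
-- (encoded as x ↦ 1 + toℕ (f x) with f into Fin (|V|+|E|)), such that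
-- f(V(G)) = [1,|V|] and f(u)+f(v)+f(uv) is constant over edges.
SuperEdgeMagic : Graph → Set
SuperEdgeMagic G =
  Σ ((Fin (order G) ⊎ Fin (size G)) ⤖ Fin (order G + size G)) λ f →
    let lab : Fin (order G) ⊎ Fin (size G) → ℕ
        lab x = suc (toℕ (Bijection.to f x))
    in (∀ w → lab (inj₁ w) ≤ order G)
       × ∃[ c ] (∀ e → lab (inj₁ (proj₁ (ends G e))) + lab (inj₁ (proj₂ (ends G e)))
                        + lab (inj₂ e) ≡ c)

-- μ_s(G) ≤ b : the least k with G ∪ kK₁ super edge-magic exists and is ≤ b,
-- i.e. some k ≤ b makes G ∪ kK₁ super edge-magic.
SEMDeficiencyAtMost : Graph → ℕ → Set
SEMDeficiencyAtMost G b = ∃[ k ] (k ≤ b × SuperEdgeMagic (addIsolated G k))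

module Submission where

-- A graph with k isolated vertices added is super edge-magic as soon as its own vertices can be
-- labelled injectively by 0, …, |V| + k - 1 so that the edge sums are |E| consecutive integers:
-- the unused labels go to the isolated vertices and the edges get the remaining labels in
-- decreasing order of their sums.
--
-- For D_n with n = 2m, fold each n-cycle into m rungs, positions j and n - 1 - j forming rung j.
-- Along both cycles small labels (2j or 2j + 1, below n) alternate with large labels (n + 4j + 1
-- or n + 4j + 3, replaced by n and n + 4m at the two ends of the fold), the u- and v-cycle out of
-- phase, so that every edge joins a small and a large label. An edge on rung j then has sum
-- n + 6j + r with r < 6, distinct edges give distinct pairs (j, r), and so the 3n edge sums are
-- n, …, 4n - 1. The n + 1 labels in [0, 3n] left over go to the isolated vertices.

open import Defs
open import Data.Bool using (Bool; true; false; not)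
open import Data.Bool.Properties using (not-involutive; not-¬)
open import Data.Empty using (⊥-elim)
open import Data.Fin
  using (Fin; #_; zero; suc; toℕ; fromℕ<; _↑ˡ_; _↑ʳ_; splitAt; join; opposite; punchIn; punchOut)
open import Data.Fin.Properties
  using (toℕ-fromℕ<; toℕ-injective; toℕ<n; toℕ-↑ˡ; toℕ-↑ʳ; splitAt-↑ˡ; splitAt-↑ʳ; splitAt-join; join-splitAt;
         opposite-prop; opposite-involutive; 0≢1+n; punchIn-injective; punchInᵢ≢i; punchOut-injective;
         punchIn-punchOut; any?; <⇒notInjective)
  renaming (_≟_ to _≟ᶠ_)
import Data.Fin.Properties as Fin
open import Data.List using (_∷_; [])
open import Data.Nat using (ℕ; zero; suc; _+_; _*_; _∸_; _≤_; _<_; _<?_; z≤n; s≤s; z<s; s≤s⁻¹; NonZero)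
open import Data.Nat.Divisibility using (_∣_; divides)
open import Data.Nat.DivMod using (_%_; [m+kn]%n≡m%n; m<n⇒m%n≡m; m%n<n; n%n≡0)
open import Data.Nat.Properties
  using (+-commutativeSemigroup; +-assoc; +-comm; +-cancelˡ-≡; *-cancelʳ-≡; suc-injective;
         ≤-refl; ≤-reflexive; ≤-trans; ≤-antisym; <-trans; ≤-<-trans; <⇒≤; <⇒≢; ≮⇒≥; n<1+n; m≤m+n; m<m+n;
         +-monoʳ-≤; +-monoˡ-<; *-monoˡ-≤; m≤n⇒∃[o]m+o≡n; m+n∸m≡n; m+n∸n≡m; m≤n⇒m∸n≡0; ∸-monoʳ-<;
         ∸-cancelˡ-≡; module ≤-Reasoning)
open import Algebra.Properties.CommutativeSemigroup +-commutativeSemigroup using (x∙yz≈y∙xz)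
open import Data.Nat.Tactic.RingSolver using (solve; solve-∀)
open import Data.Product using (_×_; _,_; proj₁; proj₂; map₁; map₂)
open import Data.Sum using (_⊎_; inj₁; inj₂; [_,_]′) renaming (map to map⊎)
open import Data.Sum.Properties using (inj₁-injective; inj₂-injective)
open import Function.Base using (id; _∘_; _∋_)
open import Function.Bundles using (mk⤖)
open import Function.Definitions using (Injective; Surjective)
open import Relation.Binary.PropositionalEquality
open import Relation.Nullary using (yes; no)
open import Relation.Nullary.Negation using (contradiction)

[,]-injective : ∀ {A B C : Set} {f : A → C} {g : B → C} → Injective _≡_ _≡_ f → Injective _≡_ _≡_ g →
                (∀ a b → f a ≢ g b) → Injective _≡_ _≡_ [ f , g ]′
[,]-injective f-injective g-injective f≢g {inj₁ x} {inj₁ y} eq = cong inj₁ (f-injective eq)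
[,]-injective f-injective g-injective f≢g {inj₁ x} {inj₂ y} eq = contradiction eq (f≢g x y)
[,]-injective f-injective g-injective f≢g {inj₂ x} {inj₁ y} eq = contradiction (sym eq) (f≢g y x)
[,]-injective f-injective g-injective f≢g {inj₂ x} {inj₂ y} eq = cong inj₂ (g-injective eq)

map⊎-injective : ∀ {A B C D : Set} {f : A → C} {g : B → D} →
                 Injective _≡_ _≡_ f → Injective _≡_ _≡_ g → Injective _≡_ _≡_ (map⊎ f g)
map⊎-injective f-injective g-injective {inj₁ x} {inj₁ y} eq = cong inj₁ (f-injective (inj₁-injective eq))
map⊎-injective f-injective g-injective {inj₂ x} {inj₂ y} eq = cong inj₂ (g-injective (inj₂-injective eq))

splitAt-injective : ∀ m n → Injective _≡_ _≡_ (splitAt m {n})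
splitAt-injective m n {x} {y} eq = begin
  x                      ≡⟨ join-splitAt m n x ⟨
  join m n (splitAt m x) ≡⟨ cong (join m n) eq ⟩
  join m n (splitAt m y) ≡⟨ join-splitAt m n y ⟩
  y                      ∎
  where open ≡-Reasoning

join-injective : ∀ m n → Injective _≡_ _≡_ (join m n)
join-injective m n {x} {y} eq = begin
  x                      ≡⟨ splitAt-join m n x ⟨
  splitAt m (join m n x) ≡⟨ cong (splitAt m) eq ⟩
  splitAt m (join m n y) ≡⟨ splitAt-join m n y ⟩
  y                      ∎
  where open ≡-Reasoning

opposite-injective : ∀ {n} → Injective _≡_ _≡_ (opposite {n})
opposite-injective {x = x} {y} eq = begin
  x                       ≡⟨ opposite-involutive x ⟨
  opposite (opposite x)   ≡⟨ cong opposite eq ⟩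
  opposite (opposite y)   ≡⟨ opposite-involutive y ⟩
  y                       ∎
  where open ≡-Reasoning

toFin : ∀ {A : Set} {N} (f : A → ℕ) → (∀ x → f x < N) → A → Fin N
toFin f f< x = fromℕ< (f< x)

toFin-injective : ∀ {A : Set} {N} (f : A → ℕ) (f< : ∀ x → f x < N) →
                  Injective _≡_ _≡_ f → Injective _≡_ _≡_ (toFin f f<)
toFin-injective f f< f-injective {x} {y} eq = f-injective (begin
  f x                      ≡⟨ toℕ-fromℕ< (f< x) ⟨
  toℕ (toFin f f< x)       ≡⟨ cong toℕ eq ⟩
  toℕ (toFin f f< y)       ≡⟨ toℕ-fromℕ< (f< y) ⟩
  f y                      ∎)
  where open ≡-Reasoning

injective⇒surjective : ∀ {n} {f : Fin n → Fin n} → Injective _≡_ _≡_ f → Surjective _≡_ _≡_ f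
injective⇒surjective {zero} _ ()
injective⇒surjective {suc n} {f} f-injective y with any? (λ x → f x ≟ᶠ y)
... | yes (x , fx≡y) = x , λ { refl → fx≡y }
... | no y∉img = ⊥-elim (<⇒notInjective (n<1+n n) punched-injective)
  where
  y≢f : ∀ x → y ≢ f x
  y≢f x y≡fx = y∉img (x , sym y≡fx)
  punched-injective : Injective _≡_ _≡_ (λ x → punchOut (y≢f x))
  punched-injective = f-injective ∘ punchOut-injective (y≢f _) (y≢f _)

module _ {a b} (f : Fin (suc a) → Fin (suc b)) (f-injective : Injective _≡_ _≡_ f) where

  f₀≢f : ∀ w → f zero ≢ f (suc w)
  f₀≢f w = 0≢1+n ∘ f-injective

  punchedTail : Fin a → Fin b
  punchedTail w = punchOut (f₀≢f w)

  punchedTail-injective : Injective _≡_ _≡_ punchedTail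
  punchedTail-injective = Fin.suc-injective ∘ f-injective ∘ punchOut-injective (f₀≢f _) (f₀≢f _)

extendInjection : ∀ {a k} (f : Fin a → Fin (a + k)) → Injective _≡_ _≡_ f → Fin (a + k) → Fin (a + k)
extendInjection {zero}  f _           x       = x
extendInjection {suc a} f _           zero    = f zero
extendInjection {suc a} f f-injective (suc x) =
  punchIn (f zero) (extendInjection (punchedTail f f-injective) (punchedTail-injective f f-injective) x)

extendInjection-↑ˡ : ∀ {a k} (f : Fin a → Fin (a + k)) (f-injective : Injective _≡_ _≡_ f) w →
                     extendInjection f f-injective (w ↑ˡ k) ≡ f w
extendInjection-↑ˡ {suc a} f _ zero = refl
extendInjection-↑ˡ {suc a} f f-injective (suc w) = begin
  punchIn (f zero) (extendInjection g g-injective (w ↑ˡ _)) ≡⟨ cong (punchIn (f zero)) (extendInjection-↑ˡ g g-injective w) ⟩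
  punchIn (f zero) (g w)                                   ≡⟨ punchIn-punchOut (f₀≢f f f-injective w) ⟩
  f (suc w)                                                ∎
  where
  open ≡-Reasoning
  g = punchedTail f f-injective
  g-injective = punchedTail-injective f f-injective

extendInjection-injective : ∀ {a k} (f : Fin a → Fin (a + k)) (f-injective : Injective _≡_ _≡_ f) →
                            Injective _≡_ _≡_ (extendInjection f f-injective)
extendInjection-injective {zero}  f _ eq = eq
extendInjection-injective {suc a} f _ {zero}  {zero}  _  = refl
extendInjection-injective {suc a} f _ {zero}  {suc y} eq = contradiction (sym eq) (punchInᵢ≢i _ _)
extendInjection-injective {suc a} f _ {suc x} {zero}  eq = contradiction eq (punchInᵢ≢i _ _)
extendInjection-injective {suc a} f f-injective {suc x} {suc y} eq =
  cong suc (extendInjection-injective (punchedTail f f-injective) (punchedTail-injective f f-injective)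
             (punchIn-injective (f zero) _ _ eq))

-- Labellings with consecutive edge sums

record ConsecutiveSumLabelling (G : Graph) (N : ℕ) : Set where
  field
    label           : Fin (order G) → ℕ
    label<          : ∀ w → label w < N
    label-injective : Injective _≡_ _≡_ label
    base            : ℕ
    rank            : Fin (size G) → ℕ
    rank<           : ∀ e → rank e < size G
    rank-injective  : Injective _≡_ _≡_ rank
    edgeSum≡        : ∀ e → label (proj₁ (ends G e)) + label (proj₂ (ends G e)) ≡ base + rank e

magicSum : ∀ {a b r} base O S → a + b ≡ base + r → r < S →
           suc a + suc b + suc (O + (S ∸ suc r)) ≡ 2 + base + O + S
magicSum {a} {b} {r} base O S sum≡ r<S with d , refl ← m≤n⇒∃[o]m+o≡n r<S = begin
  suc a + suc b + suc (O + (suc r + d ∸ suc r))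
    ≡⟨ cong (λ t → suc a + suc b + suc (O + t)) (m+n∸m≡n (suc r) d) ⟩
  suc a + suc b + suc (O + d)   ≡⟨ solve (a ∷ b ∷ O ∷ d ∷ []) ⟩
  3 + (a + b) + O + d           ≡⟨ cong (λ t → 3 + t + O + d) sum≡ ⟩
  3 + (base + r) + O + d        ≡⟨ solve (base ∷ r ∷ O ∷ d ∷ []) ⟩
  2 + base + O + (suc r + d)    ∎
  where open ≡-Reasoning

-- Vertices get 1, …, |V| and the edge of rank r gets |V| + |E| - r, so u + v + uv is constant.
consecutiveSumLabelling⇒superEdgeMagic : ∀ {G} → ConsecutiveSumLabelling G (order G) → SuperEdgeMagic G
consecutiveSumLabelling⇒superEdgeMagic {G} L =
  mk⤖ (F-injective , F-surjective) , vertexLabel≤ , 2 + base + O + S , λ e →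
    let (u , v) = ends G e in begin
      suc (toℕ (F (inj₁ u))) + suc (toℕ (F (inj₁ v))) + suc (toℕ (F (inj₂ e)))
        ≡⟨ cong₂ _+_ (cong₂ (λ a b → suc a + suc b) (toℕ-F-inj₁ u) (toℕ-F-inj₁ v)) (cong suc (toℕ-F-inj₂ e)) ⟩
      suc (label u) + suc (label v) + suc (O + (S ∸ suc (rank e)))
        ≡⟨ magicSum base O S (edgeSum≡ e) (rank< e) ⟩
      2 + base + O + S
    ∎
  where
  open ConsecutiveSumLabelling L
  open ≡-Reasoning
  O = order G
  S = size G
  vertexLabel : Fin O → Fin O
  vertexLabel = toFin label label<
  edgeLabel : Fin S → Fin S
  edgeLabel = opposite ∘ toFin rank rank<
  F : Fin O ⊎ Fin S → Fin (O + S)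
  F = join O S ∘ map⊎ vertexLabel edgeLabel
  F-injective : Injective _≡_ _≡_ F
  F-injective = map⊎-injective (toFin-injective label label< label-injective)
                  (toFin-injective rank rank< rank-injective ∘ opposite-injective)
              ∘ join-injective O S
  toℕ-F-inj₁ : ∀ w → toℕ (F (inj₁ w)) ≡ label w
  toℕ-F-inj₁ w = trans (toℕ-↑ˡ (vertexLabel w) S) (toℕ-fromℕ< (label< w))
  toℕ-F-inj₂ : ∀ e → toℕ (F (inj₂ e)) ≡ O + (S ∸ suc (rank e))
  toℕ-F-inj₂ e = trans (toℕ-↑ʳ O (edgeLabel e))
    (cong (O +_) (trans (opposite-prop (toFin rank rank< e)) (cong (λ t → S ∸ suc t) (toℕ-fromℕ< (rank< e)))))
  vertexLabel≤ : ∀ w → suc (toℕ (F (inj₁ w))) ≤ O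
  vertexLabel≤ w = subst (_< O) (sym (toℕ-F-inj₁ w)) (label< w)
  F-surjective : Surjective _≡_ _≡_ F
  F-surjective y with x , Fx≡y ← injective⇒surjective (splitAt-injective O S ∘ F-injective) y
    = splitAt O x , λ { refl → Fx≡y refl }

-- The k spare labels are handed to the isolated vertices by extending the injection to a permutation.
addIsolated-consecutiveSumLabelling : ∀ {G} k → ConsecutiveSumLabelling G (order G + k) →
                                      ConsecutiveSumLabelling (addIsolated G k) (order G + k)
addIsolated-consecutiveSumLabelling {G} k L = record
  { label           = toℕ ∘ π
  ; label<          = λ x → toℕ<n (π x)
  ; label-injective = extendInjection-injective f f-injective ∘ toℕ-injective
  ; base            = base
  ; rank            = rank
  ; rank<           = rank<
  ; rank-injective  = rank-injective
  ; edgeSum≡        = λ e → trans (cong₂ _+_ (label-↑ˡ _) (label-↑ˡ _)) (edgeSum≡ e)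
  }
  where
  open ConsecutiveSumLabelling L
  f = toFin label label<
  f-injective = toFin-injective label label< label-injective
  π = extendInjection f f-injective
  label-↑ˡ : ∀ w → toℕ (π (w ↑ˡ k)) ≡ label w
  label-↑ˡ w = trans (cong toℕ (extendInjection-↑ˡ f f-injective w)) (toℕ-fromℕ< (label< w))

consecutiveSumLabelling⇒deficiency≤ : ∀ {G k b} → k ≤ b → ConsecutiveSumLabelling G (order G + k) →
                                      SEMDeficiencyAtMost G b
consecutiveSumLabelling⇒deficiency≤ {k = k} k≤b L =
  k , k≤b , consecutiveSumLabelling⇒superEdgeMagic (addIsolated-consecutiveSumLabelling k L)

-- Two-digit numerals

numeral : ∀ d → ℕ × Fin d → ℕ
numeral d (q , r) = toℕ r + q * d

numeral-injective : ∀ d .{{_ : NonZero d}} → Injective _≡_ _≡_ (numeral d)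
numeral-injective d {q , r} {q′ , r′} eq = cong₂ _,_ q≡q′ (toℕ-injective r≡r′)
  where
  open ≡-Reasoning
  r≡r′ : toℕ r ≡ toℕ r′
  r≡r′ = begin
    toℕ r                    ≡⟨ m<n⇒m%n≡m (toℕ<n r) ⟨
    toℕ r % d                ≡⟨ [m+kn]%n≡m%n (toℕ r) q d ⟨
    (toℕ r + q * d) % d      ≡⟨ cong (_% d) eq ⟩
    (toℕ r′ + q′ * d) % d    ≡⟨ [m+kn]%n≡m%n (toℕ r′) q′ d ⟩
    toℕ r′ % d               ≡⟨ m<n⇒m%n≡m (toℕ<n r′) ⟩
    toℕ r′                   ∎
  q≡q′ : q ≡ q′
  q≡q′ = *-cancelʳ-≡ q q′ d (+-cancelˡ-≡ (toℕ r) _ _ (trans eq (cong (_+ q′ * d) (sym r≡r′))))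

numeral-< : ∀ d {q Q} (r : Fin d) → q < Q → numeral d (q , r) < Q * d
numeral-< d {q} {Q} r q<Q = begin-strict
  toℕ r + q * d   <⟨ +-monoˡ-< (q * d) (toℕ<n r) ⟩
  d + q * d       ≤⟨ *-monoˡ-≤ d q<Q ⟩
  Q * d           ∎
  where open ≤-Reasoning

numeral-injective-byDecoding : ∀ {A : Set} d .{{_ : NonZero d}} (digits : A → ℕ × Fin d) (decode : ℕ × ℕ → A) →
                               (∀ x → decode (map₂ toℕ (digits x)) ≡ x) → Injective _≡_ _≡_ (numeral d ∘ digits)
numeral-injective-byDecoding d digits decode decode-digits {x} {y} eq = begin
  x                              ≡⟨ decode-digits x ⟨
  decode (map₂ toℕ (digits x))   ≡⟨ cong (decode ∘ map₂ toℕ) (numeral-injective d eq) ⟩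
  decode (map₂ toℕ (digits y))   ≡⟨ decode-digits y ⟩
  y                              ∎
  where open ≡-Reasoning

m*2≡m+m : ∀ m → m * 2 ≡ m + m
m*2≡m+m = solve-∀

∸-suc : ∀ {m n} → n < m → m ∸ n ≡ suc (m ∸ suc n)
∸-suc {suc m} {zero}  _   = refl
∸-suc {suc m} {suc n} n<m = ∸-suc (s≤s⁻¹ n<m)

-- The labelling of the prism

even : ℕ → Bool
even zero    = true
even (suc j) = not (even j)

-- Rung j of the folded cycle C_n (n = 2m): lo j is position j and hi j is position n - 1 - j.
data Slot : Set where
  lo hi : ℕ → Slot

rung : Slot → ℕ
rung (lo j) = j
rung (hi j) = j

evenPosition : Slot → Bool
evenPosition (lo j) = even j
evenPosition (hi j) = not (even j)

hiBit : Slot → Fin 2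
hiBit (lo _) = # 0
hiBit (hi _) = # 1

smallDigits : Slot → ℕ × Fin 2
smallDigits c = rung c , hiBit c

fromSmallDigits : ℕ × ℕ → Slot
fromSmallDigits (q , zero)  = lo q
fromSmallDigits (q , suc _) = hi q

fromSmallDigits-smallDigits : ∀ c → fromSmallDigits (map₂ toℕ (smallDigits c)) ≡ c
fromSmallDigits-smallDigits (lo j) = refl
fromSmallDigits-smallDigits (hi j) = refl

data EdgeKind : Set where
  spoke smallLarge largeSmall : EdgeKind

cycleEdgeKind : Bool → EdgeKind
cycleEdgeKind true  = smallLarge
cycleEdgeKind false = largeSmall

module PrismLabelling (k : ℕ) where

  m n : ℕ
  m = 2 + k
  n = m + m

  slotAt : ℕ → Slot
  slotAt i with i <? m
  ... | yes _ = lo i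
  ... | no  _ = hi (n ∸ suc i)

  nextSlot : Slot → Slot
  nextSlot (lo j) with suc j <? m
  ... | yes _ = lo (suc j)
  ... | no  _ = hi j
  nextSlot (hi zero)    = lo zero
  nextSlot (hi (suc j)) = hi j

  Valid : Slot → Set
  Valid c = rung c < m

  slotAt-valid : ∀ {i} → i < n → Valid (slotAt i)
  slotAt-valid {i} i<n with i <? m
  ... | yes i<m = i<m
  ... | no  i≮m = subst (n ∸ suc i <_) (m+n∸n≡m m m) (∸-monoʳ-< (s≤s (≮⇒≥ i≮m)) i<n)

  slotAt-injective : ∀ {i j} → i < n → j < n → slotAt i ≡ slotAt j → i ≡ j
  slotAt-injective {i} {j} i<n j<n eq with i <? m | j <? m
  slotAt-injective i<n j<n refl | yes _ | yes _ = refl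
  slotAt-injective i<n j<n eq   | no  _ | no  _ = suc-injective (∸-cancelˡ-≡ i<n j<n (hi-injective eq))
    where hi-injective : ∀ {a b} → hi a ≡ hi b → a ≡ b
          hi-injective refl = refl
  slotAt-injective i<n j<n ()   | yes _ | no  _
  slotAt-injective i<n j<n ()   | no  _ | yes _

  slotAt-suc : ∀ {i} → suc i < n → slotAt (suc i) ≡ nextSlot (slotAt i)
  slotAt-suc {i} i+1<n with i <? m
  slotAt-suc {i} i+1<n | yes i<m with suc i <? m
  ... | yes _    = refl
  ... | no  i+1≮m with refl ← ≤-antisym (s≤s⁻¹ i<m) (s≤s⁻¹ (≮⇒≥ i+1≮m)) = cong hi (m+n∸n≡m (suc k) m)
  slotAt-suc {i} i+1<n | no i≮m with suc i <? m
  ... | yes i+1<m = contradiction (<-trans (n<1+n i) i+1<m) i≮m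
  ... | no  _ rewrite ∸-suc i+1<n = refl

  slotAt-wrap : ∀ {i} → suc i ≡ n → slotAt 0 ≡ nextSlot (slotAt i)
  slotAt-wrap {i} i+1≡n with i <? m
  ... | yes i<m = contradiction i+1≡n (<⇒≢ (≤-<-trans i<m (m<m+n m z<s)))
  ... | no  _ = sym (cong (nextSlot ∘ hi) (m≤n⇒m∸n≡0 (≤-reflexive (sym i+1≡n))))

  slotAt-next : ∀ (i : Fin n) → slotAt (toℕ (next i)) ≡ nextSlot (slotAt (toℕ i))
  slotAt-next i rewrite toℕ-fromℕ< (m%n<n (suc (toℕ i)) n) with suc (toℕ i) <? n
  ... | yes i+1<n = trans (cong slotAt (m<n⇒m%n≡m i+1<n)) (slotAt-suc i+1<n)
  ... | no  i+1≮n = trans (cong slotAt (trans (cong (_% n) i+1≡n) (n%n≡0 n))) (slotAt-wrap i+1≡n)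
    where i+1≡n = ≤-antisym (toℕ<n i) (≮⇒≥ i+1≮n)

  evenPosition-nextSlot : ∀ c → evenPosition (nextSlot c) ≡ not (evenPosition c)
  evenPosition-nextSlot (lo j) with suc j <? m
  ... | yes _ = refl
  ... | no  _ = refl
  evenPosition-nextSlot (hi zero)    = refl
  evenPosition-nextSlot (hi (suc j)) = sym (not-involutive (not (even j)))

  -- ¬ suc j < m singles out the last rung, whose hi slot gets 4m rather than 4(m - 1) + 3.
  largeDigits : Slot → ℕ × Fin 4
  largeDigits (lo zero)    = 0 , # 0
  largeDigits (lo (suc j)) = suc j , # 1
  largeDigits (hi j) with suc j <? m
  ... | yes _ = j , # 3
  ... | no  _ = suc j , # 0

  -- Matching on the remainder first keeps fromLargeDigits (q , 3) reducing for a variable q.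
  fromLargeDigits : ℕ × ℕ → Slot
  fromLargeDigits (q     , 1) = lo q
  fromLargeDigits (zero  , 0) = lo zero
  fromLargeDigits (suc q , 0) = hi q
  fromLargeDigits (q     , _) = hi q

  fromLargeDigits-largeDigits : ∀ c → fromLargeDigits (map₂ toℕ (largeDigits c)) ≡ c
  fromLargeDigits-largeDigits (lo zero)    = refl
  fromLargeDigits-largeDigits (lo (suc j)) = refl
  fromLargeDigits-largeDigits (hi j) with suc j <? m
  ... | yes _ = refl
  ... | no  _ = refl

  m*2≡n : m * 2 ≡ n
  m*2≡n = m*2≡m+m m

  m*4≡n+n : m * 4 ≡ n + n
  m*4≡n+n = quadruple m
    where quadruple : ∀ x → x * 4 ≡ (x + x) + (x + x)
          quadruple = solve-∀

  small large : Slot → ℕ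
  small c = numeral 2 (smallDigits c)
  large c = numeral 4 (largeDigits c)

  small-injective : Injective _≡_ _≡_ small
  small-injective = numeral-injective-byDecoding 2 smallDigits fromSmallDigits fromSmallDigits-smallDigits

  large-injective : Injective _≡_ _≡_ large
  large-injective = numeral-injective-byDecoding 4 largeDigits fromLargeDigits fromLargeDigits-largeDigits

  small-< : ∀ c → Valid c → small c < n
  small-< c valid = subst (small c <_) m*2≡n (numeral-< 2 (hiBit c) valid)

  large-≤ : ∀ c → Valid c → large c ≤ m * 4
  large-≤ (lo zero)    _     = z≤n
  large-≤ (lo (suc j)) valid = <⇒≤ (numeral-< 4 (# 1) valid)
  large-≤ (hi j)       valid with suc j <? m
  ... | yes _ = <⇒≤ (numeral-< 4 (# 3) valid)
  ... | no  _ = *-monoˡ-≤ 4 valid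

  labelOf : Bool × Slot → ℕ
  labelOf (true  , c) = small c
  labelOf (false , c) = n + large c

  small≢n+large : ∀ c c′ → Valid c → small c ≢ n + large c′
  small≢n+large c c′ valid = <⇒≢ (≤-trans (small-< c valid) (m≤m+n n (large c′)))

  labelOf-injective : ∀ {x y} → Valid (proj₂ x) → Valid (proj₂ y) → labelOf x ≡ labelOf y → x ≡ y
  labelOf-injective {true  , c} {true  , c′} _ _  eq = cong (true ,_) (small-injective eq)
  labelOf-injective {false , c} {false , c′} _ _  eq = cong (false ,_) (large-injective (+-cancelˡ-≡ n _ _ eq))
  labelOf-injective {true  , c} {false , c′} v _  eq = contradiction eq (small≢n+large c c′ v)
  labelOf-injective {false , c} {true  , c′} _ v′ eq = contradiction (sym eq) (small≢n+large c′ c v′)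

  labelOf-≤ : ∀ x → Valid (proj₂ x) → labelOf x ≤ n + (n + n)
  labelOf-≤ (true  , c) valid = ≤-trans (<⇒≤ (small-< c valid)) (m≤m+n n (n + n))
  labelOf-≤ (false , c) valid = +-monoʳ-≤ n (subst (large c ≤_) m*4≡n+n (large-≤ c valid))

  edgeOffset : EdgeKind × Slot → ℕ
  edgeOffset (spoke      , c) = small c + large c
  edgeOffset (smallLarge , c) = small c + large (nextSlot c)
  edgeOffset (largeSmall , c) = large c + small (nextSlot c)

  edgeRemainder : EdgeKind → Slot → Fin 6
  edgeRemainder spoke      (lo zero)    = # 0
  edgeRemainder spoke      (lo (suc _)) = # 1
  edgeRemainder spoke      (hi j) with suc j <? m
  ... | yes _ = # 4
  ... | no  _ = # 5
  edgeRemainder smallLarge (lo j) with suc j <? m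
  ... | yes _ = # 5
  ... | no  _ = # 4
  edgeRemainder smallLarge (hi zero)    = # 1
  edgeRemainder smallLarge (hi (suc _)) = # 0
  edgeRemainder largeSmall (lo zero)    = # 2
  edgeRemainder largeSmall (lo (suc j)) with suc (suc j) <? m
  ... | yes _ = # 3
  ... | no  _ = # 2
  edgeRemainder largeSmall (hi zero)    = # 3
  edgeRemainder largeSmall (hi (suc j)) with suc (suc j) <? m
  ... | yes _ = # 2
  ... | no  _ = # 3

  edgeDigits : EdgeKind × Slot → ℕ × Fin 6
  edgeDigits (t , c) = rung c , edgeRemainder t c

  fromEdgeDigits : ℕ × ℕ → EdgeKind × Slot
  fromEdgeDigits (q , 4) with suc q <? m
  ... | yes _ = spoke , hi q
  ... | no  _ = smallLarge , lo q
  fromEdgeDigits (q , 5) with suc q <? m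
  ... | yes _ = smallLarge , lo q
  ... | no  _ = spoke , hi q
  fromEdgeDigits (zero  , 0) = spoke , lo zero
  fromEdgeDigits (suc q , 0) = smallLarge , hi (suc q)
  fromEdgeDigits (zero  , 1) = smallLarge , hi zero
  fromEdgeDigits (suc q , 1) = spoke , lo (suc q)
  fromEdgeDigits (zero  , 2) = largeSmall , lo zero
  fromEdgeDigits (suc q , 2) with suc (suc q) <? m
  ... | yes _ = largeSmall , hi (suc q)
  ... | no  _ = largeSmall , lo (suc q)
  fromEdgeDigits (zero  , 3) = largeSmall , hi zero
  fromEdgeDigits (suc q , 3) with suc (suc q) <? m
  ... | yes _ = largeSmall , lo (suc q)
  ... | no  _ = largeSmall , hi (suc q)
  fromEdgeDigits _ = spoke , lo zero

  -- The decoder repeats the comparison made by edgeRemainder; 'in eq' lets us rewrite it there too.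
  fromEdgeDigits-edgeDigits : ∀ x → fromEdgeDigits (map₂ toℕ (edgeDigits x)) ≡ x
  fromEdgeDigits-edgeDigits (spoke , lo zero)    = refl
  fromEdgeDigits-edgeDigits (spoke , lo (suc _)) = refl
  fromEdgeDigits-edgeDigits (spoke , hi j) with suc j <? m in eq
  ... | yes _ rewrite eq = refl
  ... | no  _ rewrite eq = refl
  fromEdgeDigits-edgeDigits (smallLarge , lo j) with suc j <? m in eq
  ... | yes _ rewrite eq = refl
  ... | no  _ rewrite eq = refl
  fromEdgeDigits-edgeDigits (smallLarge , hi zero)    = refl
  fromEdgeDigits-edgeDigits (smallLarge , hi (suc _)) = refl
  fromEdgeDigits-edgeDigits (largeSmall , lo zero)    = refl
  fromEdgeDigits-edgeDigits (largeSmall , lo (suc j)) with suc (suc j) <? m in eq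
  ... | yes _ rewrite eq = refl
  ... | no  _ rewrite eq = refl
  fromEdgeDigits-edgeDigits (largeSmall , hi zero)    = refl
  fromEdgeDigits-edgeDigits (largeSmall , hi (suc j)) with suc (suc j) <? m in eq
  ... | yes _ rewrite eq = refl
  ... | no  _ rewrite eq = refl

  edgeOffset≡numeral : ∀ x → Valid (proj₂ x) → edgeOffset x ≡ numeral 6 (edgeDigits x)
  edgeOffset≡numeral (spoke , lo zero) _ = refl
  edgeOffset≡numeral (spoke , lo (suc j)) _ =
    (0 + suc j * 2 + (1 + suc j * 4) ≡ 1 + suc j * 6) ∋ solve (j ∷ [])
  edgeOffset≡numeral (spoke , hi j) _ with suc j <? m
  ... | yes _ = (1 + j * 2 + (3 + j * 4) ≡ 4 + j * 6) ∋ solve (j ∷ [])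
  ... | no  _ = (1 + j * 2 + (0 + suc j * 4) ≡ 5 + j * 6) ∋ solve (j ∷ [])
  edgeOffset≡numeral (smallLarge , lo j) _ with suc j <? m in eq
  ... | yes _ = (0 + j * 2 + (1 + suc j * 4) ≡ 5 + j * 6) ∋ solve (j ∷ [])
  ... | no  _ rewrite eq = (0 + j * 2 + (0 + suc j * 4) ≡ 4 + j * 6) ∋ solve (j ∷ [])
  edgeOffset≡numeral (smallLarge , hi zero) _ = refl
  edgeOffset≡numeral (smallLarge , hi (suc j)) valid with suc j <? m
  ... | yes _ = (1 + suc j * 2 + (3 + j * 4) ≡ 0 + suc j * 6) ∋ solve (j ∷ [])
  ... | no  j+1≮m = contradiction valid j+1≮m
  edgeOffset≡numeral (largeSmall , lo zero) _ = refl
  edgeOffset≡numeral (largeSmall , lo (suc j)) _ with suc (suc j) <? m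
  ... | yes _ = (1 + suc j * 4 + (0 + suc (suc j) * 2) ≡ 3 + suc j * 6) ∋ solve (j ∷ [])
  ... | no  _ = (1 + suc j * 4 + (1 + suc j * 2) ≡ 2 + suc j * 6) ∋ solve (j ∷ [])
  edgeOffset≡numeral (largeSmall , hi zero) _ = refl
  edgeOffset≡numeral (largeSmall , hi (suc j)) _ with suc (suc j) <? m
  ... | yes _ = (3 + suc j * 4 + (1 + j * 2) ≡ 2 + suc j * 6) ∋ solve (j ∷ [])
  ... | no  _ = (0 + suc (suc j) * 4 + (1 + j * 2) ≡ 3 + suc j * 6) ∋ solve (j ∷ [])

  slotOf : Fin n → Slot
  slotOf i = slotAt (toℕ i)

  slotOf-injective : Injective _≡_ _≡_ slotOf
  slotOf-injective {i} {j} = toℕ-injective ∘ slotAt-injective (toℕ<n i) (toℕ<n j)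

  -- inj₁ and inj₂ are the u- and v-cycle; the bit says whether the vertex carries a small label.
  twoSided : ∀ {X : Set} → (Bool → X) → Fin n ⊎ Fin n → X × Slot
  twoSided κ (inj₁ i) = κ (evenPosition (slotOf i)) , slotOf i
  twoSided κ (inj₂ i) = κ (not (evenPosition (slotOf i))) , slotOf i

  twoSided-valid : ∀ {X : Set} (κ : Bool → X) x → Valid (proj₂ (twoSided κ x))
  twoSided-valid κ (inj₁ i) = slotAt-valid (toℕ<n i)
  twoSided-valid κ (inj₂ i) = slotAt-valid (toℕ<n i)

  twoSided-injective : ∀ {X : Set} {κ : Bool → X} → Injective _≡_ _≡_ κ → Injective _≡_ _≡_ (twoSided κ)
  twoSided-injective κ-inj {inj₁ i} {inj₁ j} eq = cong inj₁ (slotOf-injective (cong proj₂ eq))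
  twoSided-injective κ-inj {inj₂ i} {inj₂ j} eq = cong inj₂ (slotOf-injective (cong proj₂ eq))
  twoSided-injective κ-inj {inj₁ i} {inj₂ j} eq =
    contradiction (κ-inj (cong proj₁ eq)) (not-¬ (cong (evenPosition ∘ proj₂) eq))
  twoSided-injective κ-inj {inj₂ i} {inj₁ j} eq =
    contradiction (κ-inj (sym (cong proj₁ eq))) (not-¬ (cong (evenPosition ∘ proj₂) (sym eq)))

  vertexCode : Fin (n + n) → Bool × Slot
  vertexCode = twoSided id ∘ splitAt n

  label : Fin (n + n) → ℕ
  label = labelOf ∘ vertexCode

  label-injective : Injective _≡_ _≡_ label
  label-injective {w} {w′} =
    splitAt-injective n n ∘ twoSided-injective id
      ∘ labelOf-injective (twoSided-valid id (splitAt n w)) (twoSided-valid id (splitAt n w′))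

  label-< : ∀ w → label w < n + n + (n + 1)
  label-< w =
    subst (label w <_) (rearrange n) (s≤s (labelOf-≤ (vertexCode w) (twoSided-valid id (splitAt n w))))
    where rearrange : ∀ x → suc (x + (x + x)) ≡ x + x + (x + 1)
          rearrange = solve-∀

  cycleEdgeKind-injective : Injective _≡_ _≡_ cycleEdgeKind
  cycleEdgeKind-injective {true}  {true}  _ = refl
  cycleEdgeKind-injective {false} {false} _ = refl

  cycleEdgeKind≢spoke : ∀ b → cycleEdgeKind b ≢ spoke
  cycleEdgeKind≢spoke true  ()
  cycleEdgeKind≢spoke false ()

  spokeCode : Fin n → EdgeKind × Slot
  spokeCode i = spoke , slotOf i

  edgeCode : Fin (n + n + n) → EdgeKind × Slot
  edgeCode = [ twoSided cycleEdgeKind ∘ splitAt n , spokeCode ]′ ∘ splitAt (n + n)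

  edgeCode-valid : ∀ e → Valid (proj₂ (edgeCode e))
  edgeCode-valid e with splitAt (n + n) e
  ... | inj₁ e′ = twoSided-valid cycleEdgeKind (splitAt n e′)
  ... | inj₂ i  = slotAt-valid (toℕ<n i)

  edgeCode-injective : Injective _≡_ _≡_ edgeCode
  edgeCode-injective =
    splitAt-injective (n + n) n
      ∘ [,]-injective (splitAt-injective n n ∘ twoSided-injective cycleEdgeKind-injective)
                      (slotOf-injective ∘ cong proj₂)
                      (λ e′ i → cycle≢spoke (splitAt n e′) (slotOf i))
    where
    cycle≢spoke : ∀ x c → twoSided cycleEdgeKind x ≢ (spoke , c)
    cycle≢spoke (inj₁ i) c = cycleEdgeKind≢spoke _ ∘ cong proj₁
    cycle≢spoke (inj₂ i) c = cycleEdgeKind≢spoke _ ∘ cong proj₁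

  cycleEdgeSum : ∀ b c → labelOf (b , c) + labelOf (not b , nextSlot c) ≡ n + edgeOffset (cycleEdgeKind b , c)
  cycleEdgeSum true  c = x∙yz≈y∙xz (small c) n (large (nextSlot c))
  cycleEdgeSum false c = +-assoc n (large c) (small (nextSlot c))

  spokeSum : ∀ b c → labelOf (b , c) + labelOf (not b , c) ≡ n + edgeOffset (spoke , c)
  spokeSum true  c = x∙yz≈y∙xz (small c) n (large c)
  spokeSum false c = trans (+-assoc n (large c) (small c)) (cong (n +_) (+-comm (large c) (small c)))

  label-↑ˡ : ∀ i → label (i ↑ˡ n) ≡ labelOf (evenPosition (slotOf i) , slotOf i)
  label-↑ˡ i = cong (labelOf ∘ twoSided id) (splitAt-↑ˡ n i n)

  label-↑ʳ : ∀ i → label (n ↑ʳ i) ≡ labelOf (not (evenPosition (slotOf i)) , slotOf i)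
  label-↑ʳ i = cong (labelOf ∘ twoSided id) (splitAt-↑ʳ n n i)

  parity-slotOf-next : ∀ i → (evenPosition (slotOf (next i)) , slotOf (next i))
                             ≡ (not (evenPosition (slotOf i)) , nextSlot (slotOf i))
  parity-slotOf-next i rewrite slotAt-next i = cong (_, nextSlot (slotOf i)) (evenPosition-nextSlot (slotOf i))

  label-next-↑ˡ : ∀ i → label (next i ↑ˡ n) ≡ labelOf (not (evenPosition (slotOf i)) , nextSlot (slotOf i))
  label-next-↑ˡ i = trans (label-↑ˡ (next i)) (cong labelOf (parity-slotOf-next i))

  label-next-↑ʳ : ∀ i → label (n ↑ʳ next i)
                       ≡ labelOf (not (not (evenPosition (slotOf i))) , nextSlot (slotOf i))
  label-next-↑ʳ i = trans (label-↑ʳ (next i)) (cong (labelOf ∘ map₁ not) (parity-slotOf-next i))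

  edgeSum≡edgeOffset : ∀ e → label (proj₁ (ends (prism n) e)) + label (proj₂ (ends (prism n) e))
                             ≡ n + edgeOffset (edgeCode e)
  edgeSum≡edgeOffset e with splitAt (n + n) e
  ... | inj₂ i = trans (cong₂ _+_ (label-↑ˡ i) (label-↑ʳ i))
                       (spokeSum (evenPosition (slotOf i)) (slotOf i))
  ... | inj₁ e′ with splitAt n e′
  ...   | inj₁ i = trans (cong₂ _+_ (label-↑ˡ i) (label-next-↑ˡ i))
                         (cycleEdgeSum (evenPosition (slotOf i)) (slotOf i))
  ...   | inj₂ i = trans (cong₂ _+_ (label-↑ʳ i) (label-next-↑ʳ i))
                         (cycleEdgeSum (not (evenPosition (slotOf i))) (slotOf i))

  rank : Fin (n + n + n) → ℕ
  rank = numeral 6 ∘ edgeDigits ∘ edgeCode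

  rank-< : ∀ e → rank e < n + n + n
  rank-< e = subst (rank e <_) (sextuple m) (numeral-< 6 (proj₂ (edgeDigits (edgeCode e))) (edgeCode-valid e))
    where sextuple : ∀ x → x * 6 ≡ (x + x) + (x + x) + (x + x)
          sextuple = solve-∀

  rank-injective : Injective _≡_ _≡_ rank
  rank-injective =
    edgeCode-injective ∘ numeral-injective-byDecoding 6 edgeDigits fromEdgeDigits fromEdgeDigits-edgeDigits

  edgeSum≡rank : ∀ e → label (proj₁ (ends (prism n) e)) + label (proj₂ (ends (prism n) e)) ≡ n + rank e
  edgeSum≡rank e =
    trans (edgeSum≡edgeOffset e) (cong (n +_) (edgeOffset≡numeral (edgeCode e) (edgeCode-valid e)))

  prismLabelling : ConsecutiveSumLabelling (prism n) (n + n + (n + 1))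
  prismLabelling = record
    { label           = label
    ; label<          = label-<
    ; label-injective = label-injective
    ; base            = n
    ; rank            = rank
    ; rank<           = rank-<
    ; rank-injective  = rank-injective
    ; edgeSum≡        = edgeSum≡rank
    }

mainTheorem6 : ∀ (n : ℕ) → 4 ≤ n → 2 ∣ n → SEMDeficiencyAtMost (prism n) (n + 1)
mainTheorem6 n 4≤n (divides (suc (suc k)) n≡[2+k]*2) =
  subst (λ N → SEMDeficiencyAtMost (prism N) (N + 1)) (sym n≡m+m)
    (consecutiveSumLabelling⇒deficiency≤ ≤-refl (PrismLabelling.prismLabelling k))
  where n≡m+m = trans n≡[2+k]*2 (m*2≡m+m (2 + k))
mainTheorem6 n 4≤n (divides 0 refl) = contradiction 4≤n λ ()
mainTheorem6 n 4≤n (divides 1 refl) = contradiction 4≤n λ { (s≤s (s≤s ())) }
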